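{- Let $\mathcal{M}=\mathcal{M}(\Sigma,I)$ be a trace monoid, $X$ a finite nonempty set with a right action $X\times\mathcal{M}\to X$, $(\alpha,x)\mapsto\alpha\cdot x$. Then the map $(f_\alpha)_{\alpha\in X}\mapsto(f_\alpha(a))_{(\alpha,a)\in X\times\Sigma}$ is a bijection from the set of fibred valuations onto the set of families $(\lambda_\alpha(a))_{(\alpha,a)\in X\times\Sigma}$ of real numbers satisfying the concurrency equations: for all $\alpha\in X$ and $a,b\in\Sigma$ with $(a,b)\in I$, $\lambda_\alpha(a)\lambda_{\alpha\cdot a}(b)=\lambda_\alpha(b)\lambda_{\alpha\cdot b}(a)$.
   Context: Trace monoid: $\Sigma$ finite, $|\Sigma|\ge2$, $I$ irreflexive symmetric, $\mathcal{M}=\Sigma^*/\langle ab=ba,(a,b)\in I\rangle$, unit $1$. A fibred valuation is a family $(f_\alpha)_{\alpha\in X}$ of maps $f_\alpha:\mathcal{M}\to\mathbb{R}$ such that $f_\alpha(1)=1$ and $f_\alpha(x\cdot y)=f_\alpha(x)f_{\alpha\cdot x}(y)$ for all $\alpha\in X$, $x,y\in\mathcal{M}$. -}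

module Defs where

open import Level using (Level; _⊔_; 0ℓ)
open import Data.Nat using (ℕ)
open import Data.Fin using (Fin)
open import Data.List using (List; []; _∷_; _++_; [_])
open import Data.Product using (Σ; _×_)
open import Relation.Binary.Core using (Rel)
open import Relation.Binary.PropositionalEquality using (_≡_)
open import Relation.Binary.Construct.Closure.Equivalence using (EqClosure)
open import Algebra.Bundles using (CommutativeRing)

data Swap {k : ℕ} (I : Rel (Fin k) 0ℓ) : Rel (List (Fin k)) 0ℓ where
  swap : ∀ (u v : List (Fin k)) (a b : Fin k) → I a b →
         Swap I (u ++ (a ∷ b ∷ v)) (u ++ (b ∷ a ∷ v))

-- Trace equivalence: the congruence generated by ab = ba, (a,b) ∈ I.
-- The trace monoid M(Σ,I) is List (Fin k) modulo TraceEq I.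
TraceEq : {k : ℕ} → Rel (Fin k) 0ℓ → Rel (List (Fin k)) 0ℓ
TraceEq I = EqClosure (Swap I)

-- A right action X × M → X of the trace monoid on X = Fin n,
-- presented on representatives (words), compatible with trace equivalence.
record RightAction {k : ℕ} (I : Rel (Fin k) 0ℓ) (n : ℕ) : Set where
  field
    act      : Fin n → List (Fin k) → Fin n
    act-resp : ∀ α {x y} → TraceEq I x y → act α x ≡ act α y
    act-unit : ∀ α → act α [] ≡ α
    act-mul  : ∀ α x y → act α (x ++ y) ≡ act (act α x) y

module _ {c ℓ : Level} (R : CommutativeRing c ℓ) where
  open CommutativeRing R

  record IsFibredValuation {k n : ℕ} {I : Rel (Fin k) 0ℓ} (A : RightAction I n)
         (f : Fin n → List (Fin k) → Carrier) : Set (c ⊔ ℓ) where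
    open RightAction A
    field
      f-resp : ∀ α {x y} → TraceEq I x y → f α x ≈ f α y
      f-unit : ∀ α → f α [] ≈ 1#
      f-mul  : ∀ α x y → f α (x ++ y) ≈ f α x * f (act α x) y

  Concurrency : {k n : ℕ} {I : Rel (Fin k) 0ℓ} (A : RightAction I n)
                (lam : Fin n → Fin k → Carrier) → Set ℓ
  Concurrency {I = I} A lam =
    ∀ α a b → I a b →
      lam α a * lam (RightAction.act A α [ a ]) b ≈ lam α b * lam (RightAction.act A α [ b ]) a

-- Multiplicativity forces f_α(ab) = f_α(a) f_{α·a}(b), so on a commuting pair ab = ba the
-- letter values satisfy the concurrency equations, and unfolding a word letter by letter
-- shows that a fibred valuation is determined by them. Conversely, the same unfolding,
-- read as a recursive definition on words, is multiplicative with respect to the action;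
-- the concurrency equations make it invariant under a single commutation inside a word,
-- hence under trace equivalence.
module Submission where

open import Defs
open import Level using (Level; 0ℓ)
open import Data.Nat using (ℕ; _≤_)
open import Data.Fin using (Fin)
open import Data.List using (List; []; _∷_; _++_; [_])
open import Data.Product using (Σ; _×_; _,_)
open import Relation.Binary.Core using (Rel)
open import Relation.Binary.Definitions using (Irreflexive; Symmetric)
open import Relation.Binary.PropositionalEquality as ≡ using (_≡_)
open import Relation.Binary.Construct.Closure.Equivalence using (gfold; return)
open import Algebra.Bundles using (CommutativeRing)

module _ {k n : ℕ} {I : Rel (Fin k) 0ℓ} (A : RightAction I n) where
  open RightAction A

  commute : ∀ {a b} → I a b → TraceEq I (a ∷ b ∷ []) (b ∷ a ∷ [])
  commute {a} {b} Iab = return (swap [] [] a b Iab)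

  act-commute : ∀ α {a b} → I a b → act (act α [ a ]) [ b ] ≡ act (act α [ b ]) [ a ]
  act-commute α {a} {b} Iab = begin
    act (act α [ a ]) [ b ]  ≡⟨ ≡.sym (act-mul α [ a ] [ b ]) ⟩
    act α (a ∷ b ∷ [])       ≡⟨ act-resp α (commute Iab) ⟩
    act α (b ∷ a ∷ [])       ≡⟨ act-mul α [ b ] [ a ] ⟩
    act (act α [ b ]) [ a ]  ∎
    where open ≡.≡-Reasoning

module _ {c ℓ : Level} (R : CommutativeRing c ℓ)
         {k n : ℕ} {I : Rel (Fin k) 0ℓ} (A : RightAction I n) where
  open CommutativeRing R
  open RightAction A
  open import Relation.Binary.Reasoning.Setoid setoid

  Valuation : Set c
  Valuation = Fin n → List (Fin k) → Carrier

  letters : Valuation → Fin n → Fin k → Carrier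
  letters f α a = f α [ a ]

  fibredValuation⇒concurrency : ∀ {f} → IsFibredValuation R A f → Concurrency R A (letters f)
  fibredValuation⇒concurrency {f} fv α a b Iab = begin
    f α [ a ] * f (act α [ a ]) [ b ]  ≈⟨ sym (f-mul α [ a ] [ b ]) ⟩
    f α (a ∷ b ∷ [])                   ≈⟨ f-resp α (commute A Iab) ⟩
    f α (b ∷ a ∷ [])                   ≈⟨ f-mul α [ b ] [ a ] ⟩
    f α [ b ] * f (act α [ b ]) [ a ]  ∎
    where open IsFibredValuation fv

  fibredValuation-≈-letters⇒≈ : ∀ {f g} → IsFibredValuation R A f → IsFibredValuation R A g →
    (∀ α a → f α [ a ] ≈ g α [ a ]) → ∀ α x → f α x ≈ g α x
  fibredValuation-≈-letters⇒≈ fv gv f≈g α [] =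
    trans (IsFibredValuation.f-unit fv α) (sym (IsFibredValuation.f-unit gv α))
  fibredValuation-≈-letters⇒≈ {f} {g} fv gv f≈g α (a ∷ x) = begin
    f α ([ a ] ++ x)               ≈⟨ IsFibredValuation.f-mul fv α [ a ] x ⟩
    f α [ a ] * f (act α [ a ]) x  ≈⟨ *-cong (f≈g α a) (fibredValuation-≈-letters⇒≈ fv gv f≈g (act α [ a ]) x) ⟩
    g α [ a ] * g (act α [ a ]) x  ≈⟨ sym (IsFibredValuation.f-mul gv α [ a ] x) ⟩
    g α ([ a ] ++ x)               ∎

  module Extension (lam : Fin n → Fin k → Carrier) where

    extend : Valuation
    extend α []      = 1#
    extend α (a ∷ x) = lam α a * extend (act α [ a ]) x

    extend-≡ : ∀ {α β} x → α ≡ β → extend α x ≈ extend β x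
    extend-≡ x α≡β = reflexive (≡.cong (λ γ → extend γ x) α≡β)

    extend-[_] : ∀ α a → extend α [ a ] ≈ lam α a
    extend-[_] α a = *-identityʳ (lam α a)

    extend-++ : ∀ α x y → extend α (x ++ y) ≈ extend α x * extend (act α x) y
    extend-++ α [] y = begin
      extend α y                 ≈⟨ extend-≡ y (≡.sym (act-unit α)) ⟩
      extend (act α []) y        ≈⟨ sym (*-identityˡ _) ⟩
      1# * extend (act α []) y   ∎
    extend-++ α (a ∷ x) y = begin
      lam α a * extend β (x ++ y)                   ≈⟨ *-congˡ (extend-++ β x y) ⟩
      lam α a * (extend β x * extend (act β x) y)   ≈⟨ sym (*-assoc _ _ _) ⟩
      lam α a * extend β x * extend (act β x) y     ≈⟨ *-congˡ (extend-≡ y (≡.sym (act-mul α [ a ] x))) ⟩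
      lam α a * extend β x * extend (act α (a ∷ x)) y ∎
      where β = act α [ a ]

    module _ (concurrency : Concurrency R A lam) where

      extend-commute : ∀ α u v {a b} → I a b →
        extend α (u ++ a ∷ b ∷ v) ≈ extend α (u ++ b ∷ a ∷ v)
      extend-commute α (d ∷ u) v Iab = *-congˡ (extend-commute (act α [ d ]) u v Iab)
      extend-commute α [] v {a} {b} Iab = begin
        lam α a * (lam β b * extend (act β [ b ]) v)  ≈⟨ sym (*-assoc _ _ _) ⟩
        lam α a * lam β b * extend (act β [ b ]) v    ≈⟨ *-cong (concurrency α a b Iab) (extend-≡ v (act-commute A α Iab)) ⟩
        lam α b * lam γ a * extend (act γ [ a ]) v    ≈⟨ *-assoc _ _ _ ⟩
        lam α b * (lam γ a * extend (act γ [ a ]) v)  ∎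
        where
          β = act α [ a ]
          γ = act α [ b ]

      extend-resp : ∀ α {x y} → TraceEq I x y → extend α x ≈ extend α y
      extend-resp α = gfold isEquivalence (extend α) λ where
        (swap u v a b Iab) → extend-commute α u v Iab

      extend-isFibredValuation : IsFibredValuation R A extend
      extend-isFibredValuation = record
        { f-resp = extend-resp
        ; f-unit = λ α → refl
        ; f-mul  = extend-++
        }

proposition6 : ∀ {c ℓ : Level} (R : CommutativeRing c ℓ) (k n : ℕ) → 2 ≤ k → 1 ≤ n →
    (I : Rel (Fin k) 0ℓ) → Irreflexive _≡_ I → Symmetric I → (A : RightAction I n) →
    ((f : Fin n → List (Fin k) → CommutativeRing.Carrier R) → IsFibredValuation R A f →
    Concurrency R A (λ α a → f α [ a ]))
    × ((f g : Fin n → List (Fin k) → CommutativeRing.Carrier R) →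
    IsFibredValuation R A f → IsFibredValuation R A g →
    (∀ α a → CommutativeRing._≈_ R (f α [ a ]) (g α [ a ])) →
    ∀ α x → CommutativeRing._≈_ R (f α x) (g α x))
    × ((lam : Fin n → Fin k → CommutativeRing.Carrier R) → Concurrency R A lam →
    Σ (Fin n → List (Fin k) → CommutativeRing.Carrier R) (λ f →
    IsFibredValuation R A f × (∀ α a → CommutativeRing._≈_ R (f α [ a ]) (lam α a))))
proposition6 R k n _ _ I _ _ A =
    (λ f → fibredValuation⇒concurrency R A)
  , (λ f g → fibredValuation-≈-letters⇒≈ R A)
  , λ lam concurrency →
      extend lam , extend-isFibredValuation lam concurrency , extend-[_] lam
  where open Extension R A
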